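{- Let $K$ be a field of characteristic $r>0$ and let $n\ge r$. With $p_j=\sum_{i=1}^n x_i^j$, the $K$-subalgebra $K[p_1,p_2,\ldots]\subseteq K[x_1,\ldots,x_n]$ is not finitely generated as a $K$-algebra. -}

module Defs where

open import Level using (_⊔_)
open import Algebra.Bundles using (CommutativeRing)
open import Data.Nat using (ℕ; zero; suc; _<_; _≤_)
open import Data.Fin using (Fin)
import Data.Fin as Fin
open import Data.Product using (Σ; ∃; _×_)
open import Relation.Nullary using (¬_)

record IsField {c ℓ} (R : CommutativeRing c ℓ) : Set (c ⊔ ℓ) where
  open CommutativeRing R
  field
    0≉1     : ¬ (0# ≈ 1#)
    inverse : ∀ x → ¬ (x ≈ 0#) → Σ Carrier λ y → (x * y) ≈ 1#

module _ {c ℓ} (R : CommutativeRing c ℓ) where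
  open CommutativeRing R using (Carrier; _≈_; _+_; _*_; -_; 0#; 1#)

  _·1 : ℕ → Carrier
  zero  ·1 = 0#
  suc k ·1 = 1# + (k ·1)

  HasCharacteristic : ℕ → Set ℓ
  HasCharacteristic r =
    (0 < r) × ((r ·1) ≈ 0#) × (∀ k → 0 < k → k < r → ¬ ((k ·1) ≈ 0#))

  data Term (V : Set) : Set c where
    con  : Carrier → Term V
    var  : V → Term V
    _⊕_  : Term V → Term V → Term V
    _⊗_  : Term V → Term V → Term V
    ⊖_   : Term V → Term V

  infixl 6 _⊕_
  infixl 7 _⊗_

  -- The equational theory of commutative R-algebras.  Term V modulo _≋_
  -- is the polynomial ring R[V] (the free commutative R-algebra on V).
  data _≋_ {V : Set} : Term V → Term V → Set (c ⊔ ℓ) where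
    ≋-refl  : ∀ {a} → a ≋ a
    ≋-sym   : ∀ {a b} → a ≋ b → b ≋ a
    ≋-trans : ∀ {a b d} → a ≋ b → b ≋ d → a ≋ d
    ⊕-cong  : ∀ {a a' b b'} → a ≋ a' → b ≋ b' → (a ⊕ b) ≋ (a' ⊕ b')
    ⊗-cong  : ∀ {a a' b b'} → a ≋ a' → b ≋ b' → (a ⊗ b) ≋ (a' ⊗ b')
    ⊖-cong  : ∀ {a a'} → a ≋ a' → (⊖ a) ≋ (⊖ a')
    ⊕-assoc : ∀ a b d → ((a ⊕ b) ⊕ d) ≋ (a ⊕ (b ⊕ d))
    ⊕-comm  : ∀ a b → (a ⊕ b) ≋ (b ⊕ a)
    ⊕-idˡ   : ∀ a → (con 0# ⊕ a) ≋ a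
    ⊖-invˡ  : ∀ a → ((⊖ a) ⊕ a) ≋ con 0#
    ⊗-assoc : ∀ a b d → ((a ⊗ b) ⊗ d) ≋ (a ⊗ (b ⊗ d))
    ⊗-comm  : ∀ a b → (a ⊗ b) ≋ (b ⊗ a)
    ⊗-idˡ   : ∀ a → (con 1# ⊗ a) ≋ a
    ⊗-distribˡ : ∀ a b d → (a ⊗ (b ⊕ d)) ≋ ((a ⊗ b) ⊕ (a ⊗ d))
    con-cong : ∀ {x y} → x ≈ y → con x ≋ con y
    con-+    : ∀ x y → con (x + y) ≋ (con x ⊕ con y)
    con-*    : ∀ x y → con (x * y) ≋ (con x ⊗ con y)
    con--    : ∀ x → con (- x) ≋ (⊖ con x)

  subst : ∀ {V W : Set} → (V → Term W) → Term V → Term W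
  subst σ (con x) = con x
  subst σ (var v) = σ v
  subst σ (a ⊕ b) = subst σ a ⊕ subst σ b
  subst σ (a ⊗ b) = subst σ a ⊗ subst σ b
  subst σ (⊖ a)   = ⊖ subst σ a

  _∈Alg_ : ∀ {I W : Set} → Term W → (I → Term W) → Set (c ⊔ ℓ)
  f ∈Alg g = Σ (Term _) λ e → subst g e ≋ f

  FinitelyGeneratedAlg : ∀ {I W : Set} → (I → Term W) → Set (c ⊔ ℓ)
  FinitelyGeneratedAlg {I} {W} g =
    Σ ℕ λ m → Σ (Fin m → Term W) λ h →
      (∀ i → h i ∈Alg g) ×
      (∀ f → f ∈Alg g → f ∈Alg h) ×
      (∀ f → f ∈Alg h → f ∈Alg g)

  pow : ∀ {V : Set} → Term V → ℕ → Term V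
  pow t zero    = con 1#
  pow t (suc k) = t ⊗ pow t k

  sumFin : ∀ {V : Set} (n : ℕ) → (Fin n → Term V) → Term V
  sumFin zero    f = con 0#
  sumFin (suc n) f = f Fin.zero ⊕ sumFin n (λ i → f (Fin.suc i))

  powerSum : (n j : ℕ) → Term (Fin n)
  powerSum n j = sumFin n (λ i → pow (var i) j)

{-# OPTIONS --safe #-}

-- Evaluate K[x₁,…,xₙ] in the dual numbers K[[t]][ε]/(ε²) at x₁ = t + ε, x₂ = … = x_r = t and
-- xᵢ = 0 for i > r. As r = 0 in K, the real parts cancel and p_{j+1} ↦ (j+1) tʲ ε. For each N the
-- elements with constant real part and ε-part of t-degree < N form a subalgebra containing the
-- images of p₁,…,p_N. Finitely many generators of K[p₁,p₂,…] are polynomials in p₁,…,p_N for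
-- some N, hence so is p_{rN+1}; but its image (rN+1) t^{rN} ε = t^{rN} ε lies outside that subalgebra.

module Submission where

open import Defs
open import Algebra.Bundles using (CommutativeRing; AbelianGroup; Semiring; Monoid)
open import Algebra.Structures using (IsCommutativeRing)
open import Algebra.Definitions using (Congruent₂; Associative; Commutative; LeftIdentity; _DistributesOverʳ_)
import Algebra.Consequences.Setoid as Consequences
import Algebra.Construct.Pointwise as Pointwise
import Algebra.Construct.DirectProduct as DirectProduct
open import Algebra.Morphism.Structures using (IsRingHomomorphism)
open import Level using (_⊔_)
open import Data.Empty using (⊥)
open import Data.Nat using (ℕ; zero; suc; _≤_; _<_; s≤s; z≤n) renaming (_⊔_ to _⊔ℕ_)
import Data.Nat as ℕ
open import Data.Nat.Properties using (≤-refl; <-≤-trans; m≤m⊔n; m≤n⊔m; >⇒≢; m≤n*m)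
open import Data.Fin using (Fin)
import Data.Fin as Fin
open import Data.List using (tabulate)
open import Data.List.Extrema.Nat using (max; xs≤max)
import Data.List.Relation.Unary.All.Properties as All
open import Data.Product using (_,_; proj₁; proj₂; ∃-syntax)
open import Data.Sum using (_⊎_; inj₁; inj₂)
open import Relation.Unary using (Pred)
open import Relation.Binary.PropositionalEquality as ≡ using (_≡_; _≢_)
open import Relation.Nullary using (¬_; contradiction)
open import Function using (_∘_)

module _ {c ℓ} (G : AbelianGroup c ℓ) where
  open AbelianGroup G renaming (_∙_ to _+_; ε to 0#; _⁻¹ to -_; ∙-cong to +-cong)
  open Consequences setoid

  isCommutativeRingˡ : ∀ {_*_ 1#} → Congruent₂ _≈_ _*_ → Associative _≈_ _*_ →
    Commutative _≈_ _*_ → LeftIdentity _≈_ 1# _*_ → _DistributesOverʳ_ _≈_ _*_ _+_ →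
    IsCommutativeRing _≈_ _+_ _*_ -_ 0# 1#
  isCommutativeRingˡ *-cong *-assoc *-comm *-identityˡ distribʳ = record
    { isRing = record
      { +-isAbelianGroup = isAbelianGroup
      ; *-cong = *-cong
      ; *-assoc = *-assoc
      ; *-identity = comm∧idˡ⇒id *-comm *-identityˡ
      ; distrib = comm∧distrʳ⇒distr +-cong *-comm distribʳ
      }
    ; *-comm = *-comm
    }

module _ {c ℓ} (R : Semiring c ℓ) where
  open Semiring R
  open import Algebra.Properties.Semiring.Mult R using (_×_; ×-congʳ; ×-assoc-*)

  ×-zeroʳ : ∀ n → n × 0# ≈ 0#
  ×-zeroʳ zero    = refl
  ×-zeroʳ (suc n) = trans (+-identityˡ _) (×-zeroʳ n)

  n×1≈0⇒n×x≈0 : ∀ {n} → n × 1# ≈ 0# → ∀ x → n × x ≈ 0#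
  n×1≈0⇒n×x≈0 {n} n×1≈0 x = begin
    n × x        ≈⟨ ×-congʳ n (*-identityˡ x) ⟨
    n × (1# * x) ≈⟨ ×-assoc-* n 1# x ⟨
    n × 1# * x   ≈⟨ *-congʳ n×1≈0 ⟩
    0# * x       ≈⟨ zeroˡ x ⟩
    0#           ∎
    where open import Relation.Binary.Reasoning.Setoid setoid

module _ {c ℓ} (M : Monoid c ℓ) where
  open Monoid M renaming (_∙_ to _+_; ε to 0#; ∙-congˡ to +-congˡ)
  open import Algebra.Properties.Monoid.Sum M using (sum; sum-cong-≋; sum-replicate-zero)
  open import Algebra.Properties.Monoid.Mult M using (_×_)

  leading : ∀ {m} → ℕ → Carrier → Fin m → Carrier
  leading zero    a _           = 0#
  leading (suc t) a Fin.zero    = a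
  leading (suc t) a (Fin.suc i) = leading t a i

  sum-leading : ∀ {m t} (f : Carrier → Carrier) → f 0# ≈ 0# → t ≤ m → ∀ a →
                sum {m} (f ∘ leading t a) ≈ t × f a
  sum-leading {m} {zero}  f f0≈0 _         a = trans (sum-cong-≋ {m} (λ _ → f0≈0)) (sum-replicate-zero m)
  sum-leading {suc m} {suc t} f f0≈0 (s≤s t≤m) a = +-congˡ (sum-leading {m} f f0≈0 t≤m a)

module PowerSeries {c ℓ} (R : CommutativeRing c ℓ) where
  open CommutativeRing R
  open import Algebra.Solver.Ring.NaturalCoefficients.Default commutativeSemiring
  open import Algebra.Properties.Ring ring using (-0#≈0#)
  open import Relation.Binary.Reasoning.Setoid setoid

  Series : Set c
  Series = ℕ → Carrier

  private
    +-abelianGroupₛ : AbelianGroup c ℓ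
    +-abelianGroupₛ = Pointwise.abelianGroup ℕ +-abelianGroup

  open AbelianGroup +-abelianGroupₛ public using ()
    renaming (_≈_ to _≈ₛ_; _∙_ to _+ₛ_; ε to 0ₛ)

  tail : Series → Series
  tail f k = f (suc k)

  constant : Carrier → Series
  constant a zero    = a
  constant a (suc k) = 0#

  DegreeBelow : ℕ → Series → Set ℓ
  DegreeBelow N f = ∀ k → N ≤ k → f k ≈ 0#

  IsConstant : Series → Set ℓ
  IsConstant = DegreeBelow 1

  constant-isConstant : ∀ a → IsConstant (constant a)
  constant-isConstant a (suc k) _ = refl

  infixl 7 _⋆_
  _⋆_ : Series → Series → Series
  (f ⋆ g) zero    = f 0 * g 0
  (f ⋆ g) (suc k) = f 0 * g (suc k) + (tail f ⋆ g) k

  ⋆-cong : Congruent₂ _≈ₛ_ _⋆_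
  ⋆-cong f≈f′ g≈g′ zero    = *-cong (f≈f′ 0) (g≈g′ 0)
  ⋆-cong f≈f′ g≈g′ (suc k) =
    +-cong (*-cong (f≈f′ 0) (g≈g′ (suc k))) (⋆-cong (λ k → f≈f′ (suc k)) g≈g′ k)

  ⋆-constantˡ : ∀ {f} g → IsConstant f → ∀ k → (f ⋆ g) k ≈ f 0 * g k
  ⋆-constantˡ g f-const zero    = refl
  ⋆-constantˡ {f} g f-const (suc k) = begin
    f 0 * g (suc k) + (tail f ⋆ g) k ≈⟨ +-congˡ (⋆-constantˡ g (λ k _ → f-const (suc k) (s≤s z≤n)) k) ⟩
    f 0 * g (suc k) + f 1 * g k       ≈⟨ +-congˡ (trans (*-congʳ (f-const 1 (s≤s z≤n))) (zeroˡ _)) ⟩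
    f 0 * g (suc k) + 0#              ≈⟨ +-identityʳ _ ⟩
    f 0 * g (suc k)                   ∎

  ⋆-identityˡ : LeftIdentity _≈ₛ_ (constant 1#) _⋆_
  ⋆-identityˡ f k = trans (⋆-constantˡ f (constant-isConstant 1#) k) (*-identityˡ _)

  ⋆-scaleˡ : ∀ a f g k → ((λ i → a * f i) ⋆ g) k ≈ a * (f ⋆ g) k
  ⋆-scaleˡ a f g zero    = *-assoc _ _ _
  ⋆-scaleˡ a f g (suc k) = begin
    a * f 0 * g (suc k) + ((λ i → a * f (suc i)) ⋆ g) k ≈⟨ +-cong (*-assoc _ _ _) (⋆-scaleˡ a (tail f) g k) ⟩
    a * (f 0 * g (suc k)) + a * (tail f ⋆ g) k         ≈⟨ distribˡ _ _ _ ⟨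
    a * (f ⋆ g) (suc k)                                ∎

  ⋆-distribʳ : _DistributesOverʳ_ _≈ₛ_ _⋆_ _+ₛ_
  ⋆-distribʳ h f g zero    = distribʳ _ _ _
  ⋆-distribʳ h f g (suc k) = begin
    (f 0 + g 0) * h (suc k) + ((tail f +ₛ tail g) ⋆ h) k
      ≈⟨ +-cong (distribʳ _ _ _) (⋆-distribʳ h (tail f) (tail g) k) ⟩
    (f 0 * h (suc k) + g 0 * h (suc k)) + ((tail f ⋆ h) k + (tail g ⋆ h) k)
      ≈⟨ solve 4 (λ a b c d → (a :+ b) :+ (c :+ d) := (a :+ c) :+ (b :+ d)) refl _ _ _ _ ⟩
    (f ⋆ h) (suc k) + (g ⋆ h) (suc k) ∎

  ⋆-comm : Commutative _≈ₛ_ _⋆_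
  ⋆-comm f g zero          = *-comm _ _
  ⋆-comm f g (suc zero)    =
    solve 4 (λ a b c d → a :* b :+ c :* d := d :* c :+ b :* a) refl (f 0) (g 1) (f 1) (g 0)
  ⋆-comm f g (suc (suc k)) = begin
    f 0 * g (suc (suc k)) + (tail f ⋆ g) (suc k)
      ≈⟨ +-congˡ (⋆-comm (tail f) g (suc k)) ⟩
    f 0 * g (suc (suc k)) + (g 0 * f (suc (suc k)) + (tail g ⋆ tail f) k)
      ≈⟨ +-congˡ (+-congˡ (⋆-comm (tail g) (tail f) k)) ⟩
    f 0 * g (suc (suc k)) + (g 0 * f (suc (suc k)) + (tail f ⋆ tail g) k)
      ≈⟨ solve 3 (λ a b c → a :+ (b :+ c) := b :+ (a :+ c)) refl _ _ _ ⟩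
    g 0 * f (suc (suc k)) + (f 0 * g (suc (suc k)) + (tail f ⋆ tail g) k)
      ≈⟨ +-congˡ (⋆-comm (tail g) f (suc k)) ⟨
    g 0 * f (suc (suc k)) + (tail g ⋆ f) (suc k) ∎

  ⋆-assoc : Associative _≈ₛ_ _⋆_
  ⋆-assoc f g h zero    = *-assoc _ _ _
  ⋆-assoc f g h (suc k) = begin
    (f ⋆ g) 0 * h (suc k) + (tail (f ⋆ g) ⋆ h) k
      ≈⟨ +-congˡ (⋆-distribʳ h (λ i → f 0 * tail g i) (tail f ⋆ g) k) ⟩
    (f ⋆ g) 0 * h (suc k) + (((λ i → f 0 * tail g i) ⋆ h) k + ((tail f ⋆ g) ⋆ h) k)
      ≈⟨ +-congˡ (+-cong (⋆-scaleˡ (f 0) (tail g) h k) (⋆-assoc (tail f) g h k)) ⟩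
    f 0 * g 0 * h (suc k) + (f 0 * (tail g ⋆ h) k + (tail f ⋆ (g ⋆ h)) k)
      ≈⟨ solve 5 (λ a b c d e → a :* b :* c :+ (a :* d :+ e) := a :* (b :* c :+ d) :+ e) refl _ _ _ _ _ ⟩
    f 0 * (g ⋆ h) (suc k) + (tail f ⋆ (g ⋆ h)) k ∎

  powerSeriesRing : CommutativeRing c ℓ
  powerSeriesRing = record
    { isCommutativeRing = isCommutativeRingˡ +-abelianGroupₛ ⋆-cong ⋆-assoc ⋆-comm ⋆-identityˡ ⋆-distribʳ }

  open import Algebra.Properties.Semiring.Exp (CommutativeRing.semiring powerSeriesRing)
    public using () renaming (_^_ to _^ₛ_)

  t : Series
  t zero    = 0#
  t (suc k) = constant 1# k

  t⋆-coeff-zero : ∀ f → (t ⋆ f) 0 ≈ 0#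
  t⋆-coeff-zero f = zeroˡ _

  t⋆-coeff-suc : ∀ f k → (t ⋆ f) (suc k) ≈ f k
  t⋆-coeff-suc f k = trans (+-congʳ (zeroˡ _)) (trans (+-identityˡ _) (⋆-identityˡ f k))

  t^-coeff-≡ : ∀ J → (t ^ₛ J) J ≈ 1#
  t^-coeff-≡ zero    = refl
  t^-coeff-≡ (suc J) = trans (t⋆-coeff-suc (t ^ₛ J) J) (t^-coeff-≡ J)

  t^-coeff-≢ : ∀ J k → k ≢ J → (t ^ₛ J) k ≈ 0#
  t^-coeff-≢ zero    zero    k≢J = contradiction ≡.refl k≢J
  t^-coeff-≢ zero    (suc k) k≢J = refl
  t^-coeff-≢ (suc J) zero    k≢J = t⋆-coeff-zero (t ^ₛ J)
  t^-coeff-≢ (suc J) (suc k) k≢J = trans (t⋆-coeff-suc (t ^ₛ J) k) (t^-coeff-≢ J k (k≢J ∘ ≡.cong suc))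

  DegreeBelow-resp : ∀ {N f g} → f ≈ₛ g → DegreeBelow N f → DegreeBelow N g
  DegreeBelow-resp f≈g f<N k N≤k = trans (sym (f≈g k)) (f<N k N≤k)

  +-DegreeBelow : ∀ {N f g} → DegreeBelow N f → DegreeBelow N g → DegreeBelow N (f +ₛ g)
  +-DegreeBelow f<N g<N k N≤k = trans (+-cong (f<N k N≤k) (g<N k N≤k)) (+-identityˡ 0#)

  -‿DegreeBelow : ∀ {N f} → DegreeBelow N f → DegreeBelow N (λ k → - f k)
  -‿DegreeBelow f<N k N≤k = trans (-‿cong (f<N k N≤k)) -0#≈0#

  ⋆-DegreeBelowʳ : ∀ {N f g} → IsConstant f → DegreeBelow N g → DegreeBelow N (f ⋆ g)
  ⋆-DegreeBelowʳ {g = g} f-const g<N k N≤k =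
    trans (⋆-constantˡ g f-const k) (trans (*-congˡ (g<N k N≤k)) (zeroʳ _))

  open import Algebra.Properties.Semiring.Mult (CommutativeRing.semiring powerSeriesRing)
    public using () renaming (_×_ to _×ₛ_)
  open import Algebra.Properties.Semiring.Mult semiring using (_×_)

  ×ₛ-coeff : ∀ m f k → (m ×ₛ f) k ≡ m × f k
  ×ₛ-coeff zero    f k = ≡.refl
  ×ₛ-coeff (suc m) f k = ≡.cong (f k +_) (×ₛ-coeff m f k)

module DualNumbers {c ℓ} (B : CommutativeRing c ℓ) where
  open CommutativeRing B
  open import Algebra.Solver.Ring.NaturalCoefficients.Default commutativeSemiring
  open import Algebra.Properties.Semiring.Exp semiring using (_^_)
  open import Algebra.Properties.Semiring.Mult semiring using (_×_; ×-congʳ; ×-comm-*)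

  private
    +-abelianGroupᴰ : AbelianGroup c ℓ
    +-abelianGroupᴰ = DirectProduct.abelianGroup +-abelianGroup +-abelianGroup

  open AbelianGroup +-abelianGroupᴰ using ()
    renaming ( Carrier to Dual; _≈_ to _≈ᴰ_; _∙_ to _+ᴰ_
             ; trans to ≈ᴰ-trans; sym to ≈ᴰ-sym; ∙-congʳ to +ᴰ-congʳ)

  -- (a , b) stands for a + b ε, where ε² = 0.
  infixl 7 _*ᴰ_
  _*ᴰ_ : Dual → Dual → Dual
  (a , b) *ᴰ (c , d) = a * c , a * d + b * c

  *ᴰ-cong : Congruent₂ _≈ᴰ_ _*ᴰ_
  *ᴰ-cong (a≈ , b≈) (c≈ , d≈) = *-cong a≈ c≈ , +-cong (*-cong a≈ d≈) (*-cong b≈ c≈)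

  *ᴰ-assoc : Associative _≈ᴰ_ _*ᴰ_
  *ᴰ-assoc (a , b) (c , d) (e , f) =
    solve 6 (λ a b c d e f → (a :* c) :* e := a :* (c :* e)) refl a b c d e f ,
    solve 6 (λ a b c d e f → (a :* c) :* f :+ (a :* d :+ b :* c) :* e
                           := a :* (c :* f :+ d :* e) :+ b :* (c :* e)) refl a b c d e f

  *ᴰ-comm : Commutative _≈ᴰ_ _*ᴰ_
  *ᴰ-comm (a , b) (c , d) = *-comm a c ,
    solve 4 (λ a b c d → a :* d :+ b :* c := c :* b :+ d :* a) refl a b c d

  *ᴰ-identityˡ : LeftIdentity _≈ᴰ_ (1# , 0#) _*ᴰ_
  *ᴰ-identityˡ (a , b) = *-identityˡ a , solve 2 (λ a b → con 1 :* b :+ con 0 :* a := b) refl a b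

  *ᴰ-distribʳ : _DistributesOverʳ_ _≈ᴰ_ _*ᴰ_ _+ᴰ_
  *ᴰ-distribʳ (a , b) (c , d) (e , f) = distribʳ a c e ,
    solve 6 (λ a b c d e f → (c :+ e) :* b :+ (d :+ f) :* a
                           := (c :* b :+ d :* a) :+ (e :* b :+ f :* a)) refl a b c d e f

  dualRing : CommutativeRing c ℓ
  dualRing = record
    { isCommutativeRing =
        isCommutativeRingˡ +-abelianGroupᴰ *ᴰ-cong *ᴰ-assoc *ᴰ-comm *ᴰ-identityˡ *ᴰ-distribʳ }

  open import Algebra.Properties.Semiring.Exp (CommutativeRing.semiring dualRing)
    using () renaming (_^_ to _^ᴰ_)

  ^ᴰ-real : ∀ a J → (a , 0#) ^ᴰ J ≈ᴰ (a ^ J , 0#)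
  ^ᴰ-real a zero    = refl , refl
  ^ᴰ-real a (suc J) = ≈ᴰ-trans (*ᴰ-cong {a , 0#} (refl , refl) (^ᴰ-real a J))
    (refl , solve 2 (λ a b → a :* con 0 :+ con 0 :* b := con 0) refl a (a ^ J))

  ^ᴰ-suc : ∀ a b J → (a , b) ^ᴰ suc J ≈ᴰ (a ^ suc J , suc J × (a ^ J * b))
  ^ᴰ-suc a b zero    = refl , solve 2 (λ a b → a :* con 0 :+ b :* con 1 := con 1 :* b :+ con 0) refl a b
  ^ᴰ-suc a b (suc J) =
    ≈ᴰ-trans (*ᴰ-cong {a , b} (refl , refl) (^ᴰ-suc a b J)) (refl , ε-part)
    where
    open import Relation.Binary.Reasoning.Setoid setoid
    ε-part : a * (suc J × (a ^ J * b)) + b * a ^ suc J ≈ suc (suc J) × (a ^ suc J * b)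
    ε-part = begin
      a * (suc J × (a ^ J * b)) + b * a ^ suc J ≈⟨ +-comm _ _ ⟩
      b * a ^ suc J + a * (suc J × (a ^ J * b))
        ≈⟨ +-cong (*-comm b _) (trans (×-comm-* (suc J) a _) (×-congʳ (suc J) (sym (*-assoc a _ b)))) ⟩
      a ^ suc J * b + suc J × (a ^ suc J * b) ∎

  dual-binomial : ∀ a b J → (a , b) ^ᴰ suc J ≈ᴰ (a , 0#) ^ᴰ suc J +ᴰ (0# , suc J × (a ^ J * b))
  dual-binomial a b J = ≈ᴰ-trans (^ᴰ-suc a b J) (≈ᴰ-sym
    (≈ᴰ-trans (+ᴰ-congʳ (^ᴰ-real a (suc J))) (+-identityʳ _ , +-identityˡ _)))

module Evaluation {c ℓ a ℓa} (K : CommutativeRing c ℓ) (A : CommutativeRing a ℓa)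
  {ι : CommutativeRing.Carrier K → CommutativeRing.Carrier A}
  (ι-isRingHomomorphism : IsRingHomomorphism (CommutativeRing.rawRing K) (CommutativeRing.rawRing A) ι)
  where
  open CommutativeRing A
  open IsRingHomomorphism ι-isRingHomomorphism
  open import Algebra.Properties.Semiring.Exp semiring using (_^_)
  open import Algebra.Properties.CommutativeMonoid.Sum +-commutativeMonoid using (sum)
  open import Algebra.Properties.Semiring.Mult semiring using (_×_)
  open import Algebra.Properties.Semiring.Mult (CommutativeRing.semiring K) using () renaming (_×_ to _×ᴷ_)

  ι-×-homo : ∀ n x → ι (n ×ᴷ x) ≈ n × ι x
  ι-×-homo zero    x = 0#-homo
  ι-×-homo (suc n) x = trans (+-homo x (n ×ᴷ x)) (+-congˡ (ι-×-homo n x))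

  eval : ∀ {V : Set} → (V → Carrier) → Term K V → Carrier
  eval σ (con x) = ι x
  eval σ (var v) = σ v
  eval σ (e ⊕ e′) = eval σ e + eval σ e′
  eval σ (e ⊗ e′) = eval σ e * eval σ e′
  eval σ (⊖ e)    = - eval σ e

  eval-subst : ∀ {V W : Set} (σ : W → Carrier) (τ : V → Term K W) e →
               eval σ (subst K τ e) ≡ eval (eval σ ∘ τ) e
  eval-subst σ τ (con x)  = ≡.refl
  eval-subst σ τ (var v)  = ≡.refl
  eval-subst σ τ (e ⊕ e′) = ≡.cong₂ _+_ (eval-subst σ τ e) (eval-subst σ τ e′)
  eval-subst σ τ (e ⊗ e′) = ≡.cong₂ _*_ (eval-subst σ τ e) (eval-subst σ τ e′)
  eval-subst σ τ (⊖ e)    = ≡.cong -_ (eval-subst σ τ e)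

  eval-cong : ∀ {V : Set} (σ : V → Carrier) {e e′} → _≋_ K e e′ → eval σ e ≈ eval σ e′
  eval-cong σ ≋-refl                = refl
  eval-cong σ (≋-sym p)             = sym (eval-cong σ p)
  eval-cong σ (≋-trans p q)         = trans (eval-cong σ p) (eval-cong σ q)
  eval-cong σ (⊕-cong p q)          = +-cong (eval-cong σ p) (eval-cong σ q)
  eval-cong σ (⊗-cong p q)          = *-cong (eval-cong σ p) (eval-cong σ q)
  eval-cong σ (⊖-cong p)            = -‿cong (eval-cong σ p)
  eval-cong σ (⊕-assoc _ _ _)       = +-assoc _ _ _
  eval-cong σ (⊕-comm _ _)          = +-comm _ _
  eval-cong σ (⊕-idˡ _)             = trans (+-congʳ 0#-homo) (+-identityˡ _)
  eval-cong σ (⊖-invˡ _)            = trans (-‿inverseˡ _) (sym 0#-homo)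
  eval-cong σ (⊗-assoc _ _ _)       = *-assoc _ _ _
  eval-cong σ (⊗-comm _ _)          = *-comm _ _
  eval-cong σ (⊗-idˡ _)             = trans (*-congʳ 1#-homo) (*-identityˡ _)
  eval-cong σ (⊗-distribˡ _ _ _)    = distribˡ _ _ _
  eval-cong σ (con-cong p)          = ⟦⟧-cong p
  eval-cong σ (con-+ x y)           = +-homo x y
  eval-cong σ (con-* x y)           = *-homo x y
  eval-cong σ (con-- x)             = -‿homo x

  eval-pow : ∀ {V : Set} (σ : V → Carrier) e J → eval σ (pow K e J) ≈ eval σ e ^ J
  eval-pow σ e zero    = 1#-homo
  eval-pow σ e (suc J) = *-congˡ (eval-pow σ e J)

  eval-sumFin : ∀ {V : Set} (σ : V → Carrier) n f → eval σ (sumFin K n f) ≈ sum (λ i → eval σ (f i))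
  eval-sumFin σ zero    f = 0#-homo
  eval-sumFin σ (suc n) f = +-congˡ (eval-sumFin σ n (f ∘ Fin.suc))

  _occursIn_ : ∀ {V : Set} → V → Term K V → Set
  v occursIn con _    = ⊥
  v occursIn var w    = v ≡ w
  v occursIn (e ⊕ e′) = v occursIn e ⊎ v occursIn e′
  v occursIn (e ⊗ e′) = v occursIn e ⊎ v occursIn e′
  v occursIn (⊖ e)    = v occursIn e

  varBound : Term K ℕ → ℕ
  varBound (con _)  = 0
  varBound (var v)  = suc v
  varBound (e ⊕ e′) = varBound e ⊔ℕ varBound e′
  varBound (e ⊗ e′) = varBound e ⊔ℕ varBound e′
  varBound (⊖ e)    = varBound e

  occurs⇒<varBound : ∀ {v} e → v occursIn e → v < varBound e
  occurs⇒<varBound (var v)  ≡.refl   = ≤-refl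
  occurs⇒<varBound (e ⊕ e′) (inj₁ o) = <-≤-trans (occurs⇒<varBound e o) (m≤m⊔n _ _)
  occurs⇒<varBound (e ⊕ e′) (inj₂ o) = <-≤-trans (occurs⇒<varBound e′ o) (m≤n⊔m _ _)
  occurs⇒<varBound (e ⊗ e′) (inj₁ o) = <-≤-trans (occurs⇒<varBound e o) (m≤m⊔n _ _)
  occurs⇒<varBound (e ⊗ e′) (inj₂ o) = <-≤-trans (occurs⇒<varBound e′ o) (m≤n⊔m _ _)
  occurs⇒<varBound (⊖ e)    o        = occurs⇒<varBound e o

  record IsSubalgebra {p} (S : Pred Carrier p) : Set (c ⊔ a ⊔ ℓa ⊔ p) where
    field
      ≈-resp   : ∀ {x y} → x ≈ y → S x → S y
      ι-closed : ∀ x → S (ι x)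
      +-closed : ∀ {x y} → S x → S y → S (x + y)
      *-closed : ∀ {x y} → S x → S y → S (x * y)
      -‿closed : ∀ {x} → S x → S (- x)

  module _ {p} {S : Pred Carrier p} (S-sub : IsSubalgebra S) where
    open IsSubalgebra S-sub

    eval-closed : ∀ {V : Set} {σ : V → Carrier} e → (∀ v → v occursIn e → S (σ v)) → S (eval σ e)
    eval-closed (con x)  Sσ = ι-closed x
    eval-closed (var v)  Sσ = Sσ v ≡.refl
    eval-closed (e ⊕ e′) Sσ =
      +-closed (eval-closed e (λ v → Sσ v ∘ inj₁)) (eval-closed e′ (λ v → Sσ v ∘ inj₂))
    eval-closed (e ⊗ e′) Sσ =
      *-closed (eval-closed e (λ v → Sσ v ∘ inj₁)) (eval-closed e′ (λ v → Sσ v ∘ inj₂))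
    eval-closed (⊖ e)    Sσ = -‿closed (eval-closed e Sσ)

    ∈Alg-closed : ∀ {I W : Set} {σ : W → Carrier} {f} (g : I → Term K W) (f∈g : _∈Alg_ K f g) →
                  (∀ i → i occursIn proj₁ f∈g → S (eval σ (g i))) → S (eval σ f)
    ∈Alg-closed {σ = σ} g (e , ge≋f) Sg =
      ≈-resp (eval-cong σ ge≋f) (≡.subst S (≡.sym (eval-subst σ g e)) (eval-closed e Sg))

  notFinitelyGenerated : ∀ {W : Set} {p} (σ : W → Carrier) (g : ℕ → Term K W) (S : ℕ → Pred Carrier p) →
    (∀ N → IsSubalgebra (S N)) → (∀ {N j} → j < N → S N (eval σ (g j))) →
    (∀ N → ∃[ j ] ¬ S N (eval σ (g j))) → ¬ FinitelyGeneratedAlg K g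
  notFinitelyGenerated σ g S S-sub S-gen S-miss (m , h , h∈g , g∈h , _) =
    g∉S (∈Alg-closed (S-sub N) h (g∈h (g j) (var j , ≋-refl)) (λ i _ → Sh i))
    where
    bound : Fin m → ℕ
    bound i = varBound (proj₁ (h∈g i))
    N : ℕ
    N = max 0 (tabulate bound)
    Sh : ∀ i → S N (eval σ (h i))
    Sh i = ∈Alg-closed (S-sub N) g (h∈g i) λ v o →
      S-gen (<-≤-trans (occurs⇒<varBound (proj₁ (h∈g i)) o) (All.tabulate⁻ (xs≤max 0 (tabulate bound)) i))
    j = proj₁ (S-miss N)
    g∉S = proj₂ (S-miss N)

module PowerSumsAtDualPoint {c ℓ} (K : CommutativeRing c ℓ) where
  open CommutativeRing K
  open PowerSeries K
  open DualNumbers powerSeriesRing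
  open import Algebra.Properties.Ring ring using (-0#≈0#)
  module ℙ = CommutativeRing powerSeriesRing
  module 𝔸 = CommutativeRing dualRing

  ι : Carrier → 𝔸.Carrier
  ι a = constant a , 0ₛ

  ι-isRingHomomorphism : IsRingHomomorphism rawRing 𝔸.rawRing ι
  ι-isRingHomomorphism = record
    { isSemiringHomomorphism = record
      { isNearSemiringHomomorphism = record
        { +-isMonoidHomomorphism = record
          { isMagmaHomomorphism = record
            { isRelHomomorphism = record
              { cong = λ a≈b → (λ { zero → a≈b ; (suc k) → refl }) , (λ _ → refl) }
            ; homo = λ a b → (λ { zero → refl ; (suc k) → sym (+-identityˡ 0#) })
                           , (λ _ → sym (+-identityˡ 0#)) }
          ; ε-homo = (λ { zero → refl ; (suc k) → refl }) , (λ _ → refl) }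
        ; *-homo = λ a b →
            (λ { zero → refl
               ; (suc k) → sym (⋆-DegreeBelowʳ (constant-isConstant a) (constant-isConstant b) (suc k) (s≤s z≤n)) })
          , (λ k → sym (trans (+-cong (ℙ.zeroʳ (constant a) k) (ℙ.zeroˡ (constant b) k)) (+-identityˡ 0#))) }
      ; 1#-homo = (λ _ → refl) , (λ _ → refl) }
    ; -‿homo = λ a → (λ { zero → refl ; (suc k) → sym -0#≈0# }) , (λ _ → sym -0#≈0#) }

  open Evaluation K dualRing ι-isRingHomomorphism
  open IsRingHomomorphism ι-isRingHomomorphism using (⟦⟧-cong; 0#-homo)
  open import Algebra.Properties.Semiring.Exp 𝔸.semiring using (_^_)
  open import Algebra.Properties.CommutativeMonoid.Sum 𝔸.+-commutativeMonoid using (sum; sum-cong-≋)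
  open import Algebra.Properties.Semiring.Mult 𝔸.semiring using (_×_)
  open import Algebra.Properties.Semiring.Mult ℙ.semiring using () renaming (×-congʳ to ×ₛ-congʳ)
  open import Algebra.Properties.Semiring.Mult semiring
    using (×-assocˡ) renaming (_×_ to _×ᴷ_; ×-congʳ to ×ᴷ-congʳ)

  tᴬ t+ε : 𝔸.Carrier
  tᴬ  = t , 0ₛ
  t+ε = t , ℙ.1#

  point : ∀ {n} → ℕ → Fin (suc n) → 𝔸.Carrier
  point s Fin.zero    = t+ε
  point s (Fin.suc i) = leading 𝔸.+-monoid s tᴬ i

  module _ {s : ℕ} (r×1≈0 : suc s ×ᴷ 1# ≈ 0#) where

    r×≈0 : ∀ x → suc s × x 𝔸.≈ 𝔸.0#
    r×≈0 = n×1≈0⇒n×x≈0 𝔸.semiring {suc s}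
      (𝔸.trans (𝔸.sym (ι-×-homo (suc s) 1#)) (𝔸.trans (⟦⟧-cong r×1≈0) 0#-homo))

    eval-powerSum : ∀ {n} → s ≤ n → ∀ J →
      eval (point s) (powerSum K (suc n) (suc J)) 𝔸.≈ (0ₛ , suc J ×ₛ (t ^ₛ J))
    eval-powerSum {n} s≤n J = begin
      eval (point s) (powerSum K (suc n) (suc J))
        ≈⟨ eval-sumFin (point s) (suc n) (λ i → pow K (var i) (suc J)) ⟩
      sum {suc n} (λ i → eval (point s) (pow K (var i) (suc J)))
        ≈⟨ sum-cong-≋ {suc n} (λ i → eval-pow (point s) (var i) (suc J)) ⟩
      t+ε ^ suc J 𝔸.+ sum {n} (λ i → leading 𝔸.+-monoid s tᴬ i ^ suc J)
        ≈⟨ 𝔸.+-congˡ (sum-leading 𝔸.+-monoid {n} (_^ suc J) (𝔸.zeroˡ _) s≤n tᴬ) ⟩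
      t+ε ^ suc J 𝔸.+ s × tᴬ ^ suc J
        ≈⟨ 𝔸.+-congʳ (dual-binomial t ℙ.1# J) ⟩
      (tᴬ ^ suc J 𝔸.+ ε-part) 𝔸.+ s × tᴬ ^ suc J
        ≈⟨ 𝔸.trans (𝔸.+-congʳ (𝔸.+-comm _ _)) (𝔸.+-assoc _ _ _) ⟩
      ε-part 𝔸.+ suc s × tᴬ ^ suc J
        ≈⟨ 𝔸.+-congˡ (r×≈0 _) ⟩
      ε-part 𝔸.+ 𝔸.0#
        ≈⟨ 𝔸.+-identityʳ _ ⟩
      ε-part
        ≈⟨ (λ _ → refl) , ×ₛ-congʳ (suc J) (ℙ.*-identityʳ _) ⟩
      (0ₛ , suc J ×ₛ (t ^ₛ J)) ∎
      where
      open import Relation.Binary.Reasoning.Setoid 𝔸.setoid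
      ε-part : 𝔸.Carrier
      ε-part = 0ₛ , suc J ×ₛ (t ^ₛ J ⋆ ℙ.1#)

  record LowDegree (N : ℕ) (x : 𝔸.Carrier) : Set ℓ where
    constructor _,_
    field
      real-isConstant : IsConstant (proj₁ x)
      ε-degreeBelow   : DegreeBelow N (proj₂ x)

  lowDegree-isSubalgebra : ∀ N → IsSubalgebra (LowDegree N)
  lowDegree-isSubalgebra N = record
    { ≈-resp   = λ (p , q) (c , d) → DegreeBelow-resp p c , DegreeBelow-resp q d
    ; ι-closed = λ a → constant-isConstant a , (λ _ _ → refl)
    ; +-closed = λ (c , d) (c′ , d′) → +-DegreeBelow c c′ , +-DegreeBelow d d′
    ; *-closed = λ (c , d) (c′ , d′) → ⋆-DegreeBelowʳ c c′ ,
        +-DegreeBelow (⋆-DegreeBelowʳ c d′) (DegreeBelow-resp (⋆-comm _ _) (⋆-DegreeBelowʳ c′ d))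
    ; -‿closed = λ (c , d) → -‿DegreeBelow c , -‿DegreeBelow d
    }

  powerSums-notFinitelyGenerated : ¬ (0# ≈ 1#) → ∀ {s n} → suc s ×ᴷ 1# ≈ 0# → s ≤ n →
    ¬ FinitelyGeneratedAlg K (λ j → powerSum K (suc n) (suc j))
  powerSums-notFinitelyGenerated 0≉1 {s} {n} r×1≈0 s≤n =
    notFinitelyGenerated (point s) _ LowDegree lowDegree-isSubalgebra early late
    where
    open import Relation.Binary.Reasoning.Setoid setoid
    image : ∀ J → eval (point s) (powerSum K (suc n) (suc J)) 𝔸.≈ (0ₛ , suc J ×ₛ t ^ₛ J)
    image = eval-powerSum r×1≈0 s≤n
    early : ∀ {N j} → j < N → LowDegree N (eval (point s) (powerSum K (suc n) (suc j)))
    early {N} {j} j<N = IsSubalgebra.≈-resp (lowDegree-isSubalgebra N) (𝔸.sym (image j))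
      ((λ _ _ → refl) , λ k N≤k → begin
        (suc j ×ₛ t ^ₛ j) k ≡⟨ ×ₛ-coeff (suc j) (t ^ₛ j) k ⟩
        suc j ×ᴷ (t ^ₛ j) k ≈⟨ ×ᴷ-congʳ (suc j) (t^-coeff-≢ j k (>⇒≢ (<-≤-trans j<N N≤k))) ⟩
        suc j ×ᴷ 0#         ≈⟨ ×-zeroʳ semiring (suc j) ⟩
        0#                  ∎)
    -- r ∣ M forces (M + 1) · 1 = 1, so the image of p_{M+1} has ε-coefficient 1 at t^M.
    late : ∀ N → ∃[ j ] ¬ LowDegree N (eval (point s) (powerSum K (suc n) (suc j)))
    late N = M , λ low → 0≉1 (begin
      0#                  ≈⟨ IsSubalgebra.≈-resp (lowDegree-isSubalgebra N) (image M) low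
                               .LowDegree.ε-degreeBelow M (m≤n*m N (suc s)) ⟨
      (suc M ×ₛ t ^ₛ M) M ≡⟨ ×ₛ-coeff (suc M) (t ^ₛ M) M ⟩
      suc M ×ᴷ (t ^ₛ M) M ≈⟨ ×ᴷ-congʳ (suc M) (t^-coeff-≡ M) ⟩
      1# + M ×ᴷ 1#        ≈⟨ +-congˡ M×1≈0 ⟩
      1# + 0#             ≈⟨ +-identityʳ 1# ⟩
      1#                  ∎)
      where
      M = suc s ℕ.* N
      M×1≈0 : M ×ᴷ 1# ≈ 0#
      M×1≈0 = trans (sym (×-assocˡ 1# (suc s) N)) (n×1≈0⇒n×x≈0 semiring {suc s} r×1≈0 (N ×ᴷ 1#))

module _ {c ℓ} (K : CommutativeRing c ℓ) where
  open CommutativeRing K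
  open import Algebra.Properties.Semiring.Mult semiring using (_×_)

  ·1≡×1 : ∀ k → _·1 K k ≡ k × 1#
  ·1≡×1 zero    = ≡.refl
  ·1≡×1 (suc k) = ≡.cong (1# +_) (·1≡×1 k)

corollary3p4 : ∀ {c ℓ} (K : CommutativeRing c ℓ) → IsField K → (r : ℕ) → HasCharacteristic K r → (n : ℕ) → r ≤ n → ¬ FinitelyGeneratedAlg K (λ (j : ℕ) → powerSum K n (suc j))
corollary3p4 K K-field zero    (() , _)
corollary3p4 K K-field (suc s) _               zero    ()
corollary3p4 K K-field (suc s) (_ , r·1≈0 , _) (suc n) (s≤s s≤n) =
  powerSums-notFinitelyGenerated (IsField.0≉1 K-field) r×1≈0 s≤n
  where
  open CommutativeRing K using (_≈_; 0#)
  open PowerSumsAtDualPoint K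
  r×1≈0 = ≡.subst (_≈ 0#) (·1≡×1 K (suc s)) r·1≈0
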